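{- Let $v,k$ be integers with $k\ge 3$ and $v\ge k^2-k+1$, and let $\mathcal{N}$ be the number of orbits of the affine group $AGL_1(v)$ acting on $B_{\rm con}(v,k)$ via $X\mapsto aX+b$ ($a\in\mathbb{Z}_v^*$, $b\in\mathbb{Z}_v$). Then \[ \mathcal{N}=\frac{1}{k\,\phi(v)}\sum_{l\in\mathbb{Z}_v^*}N(v,k,l), \] where $N(v,k,l)=\big|\{X\in B_{\rm con}(v,k) : 0\in X \text{ and } lX=X-x \text{ for some } x\in X\}\big|$.
   Context: $B(v,k)=\{X\subseteq\mathbb{Z}_v : |X|=k,\ |X-X|=k^2-k+1\}$, where $X-X=\{x_1-x_2:x_1,x_2\in X\}$, and $B_{\rm con}(v,k)=\{X\in B(v,k):\langle X-X\rangle=\mathbb{Z}_v\}$. For $l\in\mathbb{Z}_v^*$, $lX=\{lx:x\in X\}$. $\phi$ is Euler's function. -}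

module Defs where

open import Data.Nat using (ℕ; zero; suc; _+_; _*_; _∸_; NonZero)
open import Data.Nat.DivMod using (_mod_)
open import Data.Nat.GCD using (gcd)
open import Data.Fin using (Fin; toℕ) renaming (zero to fzero)
open import Data.Fin.Properties using (any?)
open import Data.Fin.Subset using (Subset; _∈_; ∣_∣)
open import Data.Fin.Subset.Properties using (_∈?_)
open import Data.Fin.Properties renaming (_≟_ to _≟F_) using ()
open import Data.List using (List; length; filter; upTo; map; allFin)
open import Data.Nat.ListAction using (sum)
open import Data.Vec using (tabulate)
open import Data.Product using (Σ; ∃; _×_; _,_)
open import Data.Nat.Properties using (_≟_)
open import Function.Definitions using (Injective)
open import Relation.Nullary using (Dec; yes; no; ¬_)
open import Relation.Nullary.Decidable using (⌊_⌋; _×-dec_)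
open import Relation.Binary.PropositionalEquality using (_≡_)

module _ (v : ℕ) .{{_ : NonZero v}} where

  _⊕_ : Fin v → Fin v → Fin v
  a ⊕ b = (toℕ a + toℕ b) mod v

  _⊗_ : Fin v → Fin v → Fin v
  a ⊗ b = (toℕ a * toℕ b) mod v

  ⊖_ : Fin v → Fin v
  ⊖ a = (v ∸ toℕ a) mod v

  _⊝_ : Fin v → Fin v → Fin v
  a ⊝ b = a ⊕ (⊖ b)

  zeroZ : Fin v
  zeroZ = 0 mod v

  oneZ : Fin v
  oneZ = 1 mod v

  IsUnit : Fin v → Set
  IsUnit l = ∃ λ m → (l ⊗ m) ≡ oneZ

  isUnit? : (l : Fin v) → Dec (IsUnit l)
  isUnit? l = any? (λ m → (l ⊗ m) ≟F oneZ)

  diffSet : Subset v → Subset v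
  diffSet X = tabulate λ d →
    ⌊ any? (λ x₁ → any? (λ x₂ →
        (x₁ ∈? X) ×-dec ((x₂ ∈? X) ×-dec ((x₁ ⊝ x₂) ≟F d)))) ⌋

  affImage : Fin v → Fin v → Subset v → Subset v
  affImage a b X = tabulate λ y →
    ⌊ any? (λ x → (x ∈? X) ×-dec (((a ⊗ x) ⊕ b) ≟F y)) ⌋

  data InSubgroupGen (D : Subset v) : Fin v → Set where
    gen-zero : InSubgroupGen D zeroZ
    gen-elem : ∀ {x} → x ∈ D → InSubgroupGen D x
    gen-neg  : ∀ {x} → InSubgroupGen D x → InSubgroupGen D (⊖ x)
    gen-add  : ∀ {x y} → InSubgroupGen D x → InSubgroupGen D y →
               InSubgroupGen D (x ⊕ y)

  GeneratesAll : Subset v → Set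
  GeneratesAll D = ∀ y → InSubgroupGen D y

  InB : ℕ → Subset v → Set
  InB k X = (∣ X ∣ ≡ k) × (∣ diffSet X ∣ ≡ k * k ∸ k + 1)

  InBcon : ℕ → Subset v → Set
  InBcon k X = InB k X × GeneratesAll (diffSet X)

  AffEquiv : Subset v → Subset v → Set
  AffEquiv X Y = ∃ λ a → IsUnit a × ∃ λ b → Y ≡ affImage a b X

  IsCount : (Subset v → Set) → ℕ → Set
  IsCount P n = Σ (Fin n → Subset v) λ f →
      Injective _≡_ _≡_ f × (∀ i → P (f i)) × (∀ X → P X → ∃ λ i → f i ≡ X)

  IsOrbitCount : ℕ → ℕ → Set
  IsOrbitCount k n = Σ (Fin n → Subset v) λ f →
      (∀ i → InBcon k (f i)) ×
      (∀ i j → AffEquiv (f i) (f j) → i ≡ j) ×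
      (∀ X → InBcon k X → ∃ λ i → AffEquiv X (f i))

  NSet : ℕ → Fin v → Subset v → Set
  NSet k l X = InBcon k X × zeroZ ∈ X ×
               ∃ λ x → x ∈ X × affImage l zeroZ X ≡ affImage oneZ (⊖ x) X

  sumUnits : (Fin v → ℕ) → ℕ
  sumUnits g = sum (map g (filter isUnit? (allFin v)))

φ : ℕ → ℕ
φ v = length (filter (λ m → gcd m v ≟ 1) (map suc (upTo v)))

-- Count the triples (O , a , r) of an orbit O, a unit a and a point r of the representative R_O:
-- there are 𝒩 φ(v) k of them.  Each triple yields X = a (R_O − r), a set of the orbit containing 0.
-- Fix for every such X a placement X = a₀ (R_O − r₀) and put l = a a₀⁻¹; then
-- l X = a (R_O − r₀) = X − x with x = a (r₀ − r) ∈ X, so X is counted by N(v,k,l).  Conversely, from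
-- l X = X − x one recovers a = l a₀ and r = r₀ − a⁻¹ x, so (O , a , r) ↦ (l , X) is a bijection onto
-- the pairs counted by Σ_l N(v,k,l).  That x is determined by (l , X) is the one arithmetic input:
-- a translation t ≠ 0 fixing X would make t = (x + t) − x = (x + 2t) − (x + t) a repeated difference,
-- whereas k elements with k² − k + 1 differences have all k(k − 1) differences of distinct pairs distinct.
module Submission where

open import Algebra.Bundles using (CommutativeRing)
open import Algebra.Consequences.Propositional using (comm∧idˡ⇒id; comm∧invʳ⇒inv; comm∧distrˡ⇒distrʳ)
import Algebra.Properties.Ring as RingProperties
import Algebra.Solver.Ring as RingSolver
open import Algebra.Solver.Ring.AlmostCommutativeRing using (fromCommutativeRing; _-Raw-AlmostCommutative⟶_)
open import Axiom.UniquenessOfIdentityProofs using (module Decidable⇒UIP)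
import Data.Bool as Bool
open import Data.Bool using (Bool; true; false; if_then_else_)
open import Data.Bool.Properties using (T-≡; T-irrelevant)
import Data.Fin as Fin
open import Data.Fin using (Fin; toℕ; punchIn; punchOut; combine; remQuot)
open import Data.Fin.Properties
  using (+↔⊎; *↔×; injective⇒≤; cantor-schröder-bernstein; toℕ-fromℕ<; toℕ-injective; toℕ<n; _≟_; any?;
         punchIn-punchOut; remQuot-combine; combine-injectiveˡ; suc-injective)
open import Data.Fin.Subset using (Subset; _∈_; _⊆_; ∣_∣; inside; outside)
open import Data.Fin.Subset.Properties using (_∈?_; ⊆-antisym; drop-there)
import Data.Integer
open import Data.Integer as ℤ using (ℤ; -[1+_]; _⊖_)
import Data.Integer.Properties as ℤ
open import Data.List using (List; []; _∷_; length; filter; map; tabulate; applyUpTo; upTo)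
open import Data.List.Properties using (map-tabulate; map-applyUpTo)
open import Data.Maybe using (Maybe; just; nothing)
open import Data.Nat as ℕ using (ℕ; zero; suc; _+_; _*_; _∸_; _≤_; NonZero; _%_)
open import Data.Nat.DivMod using (_mod_; %-distribˡ-+; %-distribˡ-*; n%n≡0; m*n%n≡0; m<n⇒m%n≡m; [m+kn]%n≡m%n)
open import Data.Nat.Divisibility using (_∣_; ∣1⇒≡1; ∣n∣m%n⇒∣m; %-presˡ-∣; ∣m⇒∣m*n)
open import Data.Nat.GCD using (gcd; GCD; gcd-GCD; gcd[m,n]∣m; gcd[m,n]∣n; module Bézout)
open import Data.Nat.ListAction using (sum)
import Data.Nat.Properties as ℕ
open import Data.Product using (Σ; ∃; ∃₂; _×_; _,_; proj₁; proj₂)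
open import Data.Product.Algebra using (Σ-assoc-alt)
open import Data.Product.Function.Dependent.Propositional using (Σ-↔)
open import Data.Product.Function.NonDependent.Propositional using (_×-↔_)
import Data.Sign as Sign
open import Data.Sum using (_⊎_; inj₁; inj₂)
open import Data.Sum.Function.Propositional using (_⊎-↔_)
import Data.Vec as Vec
open import Data.Vec using ([]; _∷_; here; there)
open import Data.Vec.Properties using (≡-dec; lookup⇒[]=; []=⇒lookup; lookup∘tabulate)
open import Function using (_∘_; id; _↔_; mk↔ₛ′; Inverse; Injection; Equivalence)
open import Function.Properties.Inverse using (↔-refl; ↔-sym; ↔-trans; ↔⇒↣)
open import Level using (0ℓ)
open import Relation.Binary.PropositionalEquality
  using (_≡_; _≢_; refl; isEquivalence; sym; trans; cong; cong₂; subst; module ≡-Reasoning)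
open import Relation.Nullary using (Dec; yes; no; does; contradiction; Irrelevant)
open import Relation.Nullary.Decidable using (⌊_⌋; fromWitness; toWitness; _×-dec_; map′)
open import Relation.Unary using (Pred; Decidable)

open import Defs

private variable
  m n : ℕ
  A : Set

↔⇒≡ : Fin m ↔ Fin n → m ≡ n
↔⇒≡ e = cantor-schröder-bernstein (Injection.injective (↔⇒↣ e)) (Injection.injective (↔⇒↣ (↔-sym e)))

surjective⇒≤ : (f : Fin m → A) → Fin n ↔ A → (∀ a → ∃ λ i → f i ≡ a) → n ≤ m
surjective⇒≤ f e surj = injective⇒≤ {f = section} section-injective
  where
  open Inverse e
  section : Fin _ → Fin _
  section y = proj₁ (surj (to y))
  section-injective : ∀ {y y′} → section y ≡ section y′ → y ≡ y′
  section-injective {y} {y′} eq =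
    Injection.injective (↔⇒↣ e) (trans (sym (proj₂ (surj (to y)))) (trans (cong f eq) (proj₂ (surj (to y′)))))

surjective-collision⇒≤ : (f : Fin (suc m) → A) → Fin n ↔ A → (∀ a → ∃ λ i → f i ≡ a) →
  ∀ {i j} → i ≢ j → f i ≡ f j → n ≤ m
surjective-collision⇒≤ f e surj {i} {j} i≢j fi≡fj = surjective⇒≤ (f ∘ punchIn j) e surj′
  where
  surj′ : ∀ a → ∃ λ c → f (punchIn j c) ≡ _
  surj′ a with proj₁ (surj a) ≟ j | proj₂ (surj a)
  ... | yes refl | fc≡a = punchOut (i≢j ∘ sym) , trans (cong f (punchIn-punchOut (i≢j ∘ sym))) (trans fi≡fj fc≡a)
  ... | no c≢j   | fc≡a = punchOut (c≢j ∘ sym) , trans (cong f (punchIn-punchOut (c≢j ∘ sym))) fc≡a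

Σ-Fin-suc↔ : {B : Fin (suc n) → Set} → Σ (Fin (suc n)) B ↔ (B Fin.zero ⊎ Σ (Fin n) (B ∘ Fin.suc))
Σ-Fin-suc↔ = mk↔ₛ′
  (λ { (Fin.zero , b) → inj₁ b ; (Fin.suc i , b) → inj₂ (i , b) })
  (λ { (inj₁ b) → Fin.zero , b ; (inj₂ (i , b)) → Fin.suc i , b })
  (λ { (inj₁ b) → refl ; (inj₂ _) → refl })
  (λ { (Fin.zero , _) → refl ; (Fin.suc _ , _) → refl })

Fin-sum↔Σ : (g : Fin n → ℕ) → Fin (sum (tabulate g)) ↔ Σ (Fin n) (Fin ∘ g)
Fin-sum↔Σ {zero}  g = mk↔ₛ′ (λ ()) (λ { (() , _) }) (λ { (() , _) }) (λ ())
Fin-sum↔Σ {suc n} g = ↔-trans +↔⊎ (↔-trans (↔-refl ⊎-↔ Fin-sum↔Σ (g ∘ Fin.suc)) (↔-sym Σ-Fin-suc↔))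

Fin-if↔ : {P : Set} (P? : Dec P) → Irrelevant P → Fin (if does P? then n else 0) ↔ (P × Fin n)
Fin-if↔ (yes p) irr = mk↔ₛ′ (p ,_) proj₂ (λ { (q , _) → cong (_, _) (irr p q) }) (λ _ → refl)
Fin-if↔ (no ¬p) irr = mk↔ₛ′ (λ ()) (λ (p , _) → contradiction p ¬p) (λ (p , _) → contradiction p ¬p) (λ ())

sum-map-filter : {P : Pred A 0ℓ} (P? : Decidable P) (g : A → ℕ) (xs : List A) →
  sum (map g (filter P? xs)) ≡ sum (map (λ x → if does (P? x) then g x else 0) xs)
sum-map-filter P? g []       = refl
sum-map-filter P? g (x ∷ xs) with does (P? x)
... | true  = cong (g x +_) (sum-map-filter P? g xs)
... | false = sum-map-filter P? g xs

Fin-sum-filter↔ : {P : Pred A 0ℓ} (P? : Decidable P) → (∀ {x} → Irrelevant (P x)) → (g : A → ℕ) (f : Fin n → A) →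
  Fin (sum (map g (filter P? (tabulate f)))) ↔ Σ (Fin n) (λ i → P (f i) × Fin (g (f i)))
Fin-sum-filter↔ P? irr g f = subst (λ s → Fin s ↔ _) (sym sum≡)
  (↔-trans (Fin-sum↔Σ _) (Σ-↔ ↔-refl (λ {i} → Fin-if↔ (P? (f i)) irr)))
  where
  sum≡ : sum (map g (filter P? (tabulate f))) ≡ sum (tabulate (λ i → if does (P? (f i)) then g (f i) else 0))
  sum≡ = trans (sum-map-filter P? g (tabulate f)) (cong sum (map-tabulate f _))

length≡sum-map-1 : (xs : List A) → length xs ≡ sum (map (λ _ → 1) xs)
length≡sum-map-1 []       = refl
length≡sum-map-1 (x ∷ xs) = cong suc (length≡sum-map-1 xs)

×-Fin1↔ : {P : Set} → (P × Fin 1) ↔ P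
×-Fin1↔ = mk↔ₛ′ proj₁ (_, Fin.zero) (λ _ → refl) (λ { (_ , Fin.zero) → refl ; (_ , Fin.suc ()) })

Fin-length-filter↔ : {P : Pred A 0ℓ} (P? : Decidable P) → (∀ {x} → Irrelevant (P x)) → (f : Fin n → A) →
  Fin (length (filter P? (tabulate f))) ↔ Σ (Fin n) (P ∘ f)
Fin-length-filter↔ P? irr f = subst (λ s → Fin s ↔ _) (sym (length≡sum-map-1 (filter P? (tabulate f))))
  (↔-trans (Fin-sum-filter↔ P? irr (λ _ → 1) f) (Σ-↔ ↔-refl ×-Fin1↔))

applyUpTo≡tabulate : (f : ℕ → A) (n : ℕ) → applyUpTo f n ≡ tabulate {n = n} (f ∘ toℕ)
applyUpTo≡tabulate f zero    = refl
applyUpTo≡tabulate f (suc n) = cong (f 0 ∷_) (applyUpTo≡tabulate (f ∘ suc) n)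

∈-irrelevant : {x : Fin n} {X : Subset n} → Irrelevant (x ∈ X)
∈-irrelevant here      here      = refl
∈-irrelevant (there p) (there q) = cong there (∈-irrelevant p q)

Elem : Subset n → Set
Elem {n} X = Σ (Fin n) (_∈ X)

Elem-∷↔ : {b : Bool} {X : Subset n} → Elem (b ∷ X) ↔ (Fin.zero ∈ b ∷ X ⊎ Elem X)
Elem-∷↔ = ↔-trans Σ-Fin-suc↔
  (↔-refl ⊎-↔ Σ-↔ ↔-refl (mk↔ₛ′ drop-there there (λ _ → refl) (λ { (there _) → refl })))

Fin∣∣↔Elem : (X : Subset n) → Fin ∣ X ∣ ↔ Elem X
Fin∣∣↔Elem []            = mk↔ₛ′ (λ ()) (λ { (() , _) }) (λ { (() , _) }) (λ ())
Fin∣∣↔Elem (inside ∷ X)  = ↔-trans (+↔⊎ {1}) (↔-trans (here↔ ⊎-↔ Fin∣∣↔Elem X) (↔-sym Elem-∷↔))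
  where
  here↔ : Fin 1 ↔ (Fin.zero ∈ inside ∷ X)
  here↔ = mk↔ₛ′ (λ _ → here) (λ _ → Fin.zero) (λ { here → refl }) (λ { Fin.zero → refl ; (Fin.suc ()) })
Fin∣∣↔Elem (outside ∷ X) = ↔-trans (+↔⊎ {0}) (↔-trans (absent↔ ⊎-↔ Fin∣∣↔Elem X) (↔-sym Elem-∷↔))
  where
  absent↔ : Fin 0 ↔ (Fin.zero ∈ outside ∷ X)
  absent↔ = mk↔ₛ′ (λ ()) (λ ()) (λ ()) (λ ())

module _ {P : Fin n → Set} (P? : ∀ y → Dec (P y)) where

  ∈-tabulate⁺ : ∀ {y} → P y → y ∈ Vec.tabulate (λ y → ⌊ P? y ⌋)
  ∈-tabulate⁺ {y} p = lookup⇒[]= y _ (trans (lookup∘tabulate _ y) (Equivalence.to T-≡ (fromWitness p)))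

  ∈-tabulate⁻ : ∀ {y} → y ∈ Vec.tabulate (λ y → ⌊ P? y ⌋) → P y
  ∈-tabulate⁻ {y} y∈ = toWitness {a? = P? y} (Equivalence.from T-≡ (trans (sym (lookup∘tabulate _ y)) ([]=⇒lookup y∈)))

Elem-≡ : {X : Subset n} {p q : Elem X} → proj₁ p ≡ proj₁ q → p ≡ q
Elem-≡ {p = x , x∈} {.x , x∈′} refl = cong (x ,_) (∈-irrelevant x∈ x∈′)

choose : {P : Set} → Dec P → P → P
choose P? p = toWitness {a? = P?} (fromWitness p)

choose-irrelevant : {P : Set} (P? : Dec P) (p q : P) → choose P? p ≡ choose P? q
choose-irrelevant P? p q = cong (toWitness {a? = P?}) (T-irrelevant (fromWitness p) (fromWitness q))

module Mod (v : ℕ) .{{_ : NonZero v}} where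

  open Data.Integer using (+_)

  -- The ring ℤ_v

  infixl 6 _+ᵥ_ _-ᵥ_
  infixl 7 _*ᵥ_
  infix 8 -ᵥ_

  _+ᵥ_ _*ᵥ_ _-ᵥ_ : Fin v → Fin v → Fin v
  _+ᵥ_ = _⊕_ v
  _*ᵥ_ = _⊗_ v
  _-ᵥ_ = _⊝_ v

  -ᵥ_ : Fin v → Fin v
  -ᵥ_ = ⊖_ v

  0ᵥ 1ᵥ : Fin v
  0ᵥ = zeroZ v
  1ᵥ = oneZ v

  [_] : ℕ → Fin v
  [ m ] = m mod v

  toℕ-[] : ∀ m → toℕ [ m ] ≡ m % v
  toℕ-[] m = toℕ-fromℕ< _

  []-≡ : ∀ {m n} → m % v ≡ n % v → [ m ] ≡ [ n ]
  []-≡ {m} {n} eq = toℕ-injective (trans (toℕ-[] m) (trans eq (sym (toℕ-[] n))))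

  []-toℕ : ∀ a → [ toℕ a ] ≡ a
  []-toℕ a = toℕ-injective (trans (toℕ-[] (toℕ a)) (m<n⇒m%n≡m (toℕ<n a)))

  []-+ : ∀ m n → [ m ℕ.+ n ] ≡ [ m ] +ᵥ [ n ]
  []-+ m n = []-≡ (trans (%-distribˡ-+ m n v)
    (sym (cong₂ (λ a b → (a ℕ.+ b) % v) (toℕ-[] m) (toℕ-[] n))))

  []-* : ∀ m n → [ m ℕ.* n ] ≡ [ m ] *ᵥ [ n ]
  []-* m n = []-≡ (trans (%-distribˡ-* m n v)
    (sym (cong₂ (λ a b → (a ℕ.* b) % v) (toℕ-[] m) (toℕ-[] n))))

  private
    ⟦_⟧ : Fin v → ℕ
    ⟦_⟧ = toℕ

  +ᵥ-assoc : ∀ a b c → (a +ᵥ b) +ᵥ c ≡ a +ᵥ (b +ᵥ c)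
  +ᵥ-assoc a b c = begin
    (a +ᵥ b) +ᵥ c                  ≡⟨ cong ((a +ᵥ b) +ᵥ_) ([]-toℕ c) ⟨
    [ ⟦ a ⟧ ℕ.+ ⟦ b ⟧ ] +ᵥ [ ⟦ c ⟧ ] ≡⟨ []-+ (⟦ a ⟧ ℕ.+ ⟦ b ⟧) ⟦ c ⟧ ⟨
    [ ⟦ a ⟧ ℕ.+ ⟦ b ⟧ ℕ.+ ⟦ c ⟧ ]   ≡⟨ cong [_] (ℕ.+-assoc ⟦ a ⟧ ⟦ b ⟧ ⟦ c ⟧) ⟩
    [ ⟦ a ⟧ ℕ.+ (⟦ b ⟧ ℕ.+ ⟦ c ⟧) ] ≡⟨ []-+ ⟦ a ⟧ (⟦ b ⟧ ℕ.+ ⟦ c ⟧) ⟩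
    [ ⟦ a ⟧ ] +ᵥ (b +ᵥ c)          ≡⟨ cong (_+ᵥ (b +ᵥ c)) ([]-toℕ a) ⟩
    a +ᵥ (b +ᵥ c)                  ∎
    where open ≡-Reasoning

  *ᵥ-assoc : ∀ a b c → (a *ᵥ b) *ᵥ c ≡ a *ᵥ (b *ᵥ c)
  *ᵥ-assoc a b c = begin
    (a *ᵥ b) *ᵥ c                  ≡⟨ cong ((a *ᵥ b) *ᵥ_) ([]-toℕ c) ⟨
    [ ⟦ a ⟧ ℕ.* ⟦ b ⟧ ] *ᵥ [ ⟦ c ⟧ ] ≡⟨ []-* (⟦ a ⟧ ℕ.* ⟦ b ⟧) ⟦ c ⟧ ⟨
    [ ⟦ a ⟧ ℕ.* ⟦ b ⟧ ℕ.* ⟦ c ⟧ ]   ≡⟨ cong [_] (ℕ.*-assoc ⟦ a ⟧ ⟦ b ⟧ ⟦ c ⟧) ⟩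
    [ ⟦ a ⟧ ℕ.* (⟦ b ⟧ ℕ.* ⟦ c ⟧) ] ≡⟨ []-* ⟦ a ⟧ (⟦ b ⟧ ℕ.* ⟦ c ⟧) ⟩
    [ ⟦ a ⟧ ] *ᵥ (b *ᵥ c)          ≡⟨ cong (_*ᵥ (b *ᵥ c)) ([]-toℕ a) ⟩
    a *ᵥ (b *ᵥ c)                  ∎
    where open ≡-Reasoning

  *ᵥ-distribˡ-+ᵥ : ∀ a b c → a *ᵥ (b +ᵥ c) ≡ a *ᵥ b +ᵥ a *ᵥ c
  *ᵥ-distribˡ-+ᵥ a b c = begin
    a *ᵥ (b +ᵥ c)                              ≡⟨ cong (_*ᵥ (b +ᵥ c)) ([]-toℕ a) ⟨
    [ ⟦ a ⟧ ] *ᵥ [ ⟦ b ⟧ ℕ.+ ⟦ c ⟧ ]            ≡⟨ []-* ⟦ a ⟧ (⟦ b ⟧ ℕ.+ ⟦ c ⟧) ⟨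
    [ ⟦ a ⟧ ℕ.* (⟦ b ⟧ ℕ.+ ⟦ c ⟧) ]             ≡⟨ cong [_] (ℕ.*-distribˡ-+ ⟦ a ⟧ ⟦ b ⟧ ⟦ c ⟧) ⟩
    [ ⟦ a ⟧ ℕ.* ⟦ b ⟧ ℕ.+ ⟦ a ⟧ ℕ.* ⟦ c ⟧ ]     ≡⟨ []-+ (⟦ a ⟧ ℕ.* ⟦ b ⟧) (⟦ a ⟧ ℕ.* ⟦ c ⟧) ⟩
    a *ᵥ b +ᵥ a *ᵥ c                           ∎
    where open ≡-Reasoning

  +ᵥ-comm : ∀ a b → a +ᵥ b ≡ b +ᵥ a
  +ᵥ-comm a b = cong [_] (ℕ.+-comm ⟦ a ⟧ ⟦ b ⟧)

  *ᵥ-comm : ∀ a b → a *ᵥ b ≡ b *ᵥ a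
  *ᵥ-comm a b = cong [_] (ℕ.*-comm ⟦ a ⟧ ⟦ b ⟧)

  +ᵥ-identityˡ : ∀ a → 0ᵥ +ᵥ a ≡ a
  +ᵥ-identityˡ a = trans (cong (0ᵥ +ᵥ_) (sym ([]-toℕ a))) (trans (sym ([]-+ 0 ⟦ a ⟧)) ([]-toℕ a))

  *ᵥ-identityˡ : ∀ a → 1ᵥ *ᵥ a ≡ a
  *ᵥ-identityˡ a = begin
    1ᵥ *ᵥ a               ≡⟨ cong (1ᵥ *ᵥ_) ([]-toℕ a) ⟨
    [ 1 ] *ᵥ [ ⟦ a ⟧ ]    ≡⟨ []-* 1 ⟦ a ⟧ ⟨
    [ 1 ℕ.* ⟦ a ⟧ ]       ≡⟨ cong [_] (ℕ.*-identityˡ ⟦ a ⟧) ⟩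
    [ ⟦ a ⟧ ]             ≡⟨ []-toℕ a ⟩
    a                     ∎
    where open ≡-Reasoning

  -ᵥ-inverseʳ : ∀ a → a +ᵥ -ᵥ a ≡ 0ᵥ
  -ᵥ-inverseʳ a = begin
    a +ᵥ -ᵥ a                   ≡⟨ cong (_+ᵥ -ᵥ a) ([]-toℕ a) ⟨
    [ ⟦ a ⟧ ] +ᵥ [ v ℕ.∸ ⟦ a ⟧ ] ≡⟨ []-+ ⟦ a ⟧ (v ℕ.∸ ⟦ a ⟧) ⟨
    [ ⟦ a ⟧ ℕ.+ (v ℕ.∸ ⟦ a ⟧) ]  ≡⟨ cong [_] (ℕ.m+[n∸m]≡n (ℕ.<⇒≤ (toℕ<n a))) ⟩
    [ v ]                       ≡⟨ []-≡ (trans (n%n≡0 v) (sym (m*n%n≡0 0 v))) ⟩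
    [ 0 ]                       ∎
    where open ≡-Reasoning

  ℤᵥ : CommutativeRing _ _
  ℤᵥ = record
    { Carrier = Fin v ; _≈_ = _≡_ ; _+_ = _+ᵥ_ ; _*_ = _*ᵥ_ ; -_ = (-ᵥ_) ; 0# = 0ᵥ ; 1# = 1ᵥ
    ; isCommutativeRing = record
      { isRing = record
        { +-isAbelianGroup = record
          { isGroup = record
            { isMonoid = record
              { isSemigroup = record
                { isMagma = record { isEquivalence = isEquivalence ; ∙-cong = cong₂ _+ᵥ_ }
                ; assoc = +ᵥ-assoc }
              ; identity = comm∧idˡ⇒id +ᵥ-comm +ᵥ-identityˡ }
            ; inverse = comm∧invʳ⇒inv +ᵥ-comm -ᵥ-inverseʳ
            ; ⁻¹-cong = cong (-ᵥ_) }
          ; comm = +ᵥ-comm }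
        ; *-cong = cong₂ _*ᵥ_
        ; *-assoc = *ᵥ-assoc
        ; *-identity = comm∧idˡ⇒id *ᵥ-comm *ᵥ-identityˡ
        ; distrib = *ᵥ-distribˡ-+ᵥ , comm∧distrˡ⇒distrʳ *ᵥ-comm *ᵥ-distribˡ-+ᵥ }
      ; *-comm = *ᵥ-comm } }

  open CommutativeRing ℤᵥ using (zeroˡ; zeroʳ; +-assoc; +-identityʳ; *-identityʳ; -‿inverseʳ)
  open RingProperties (CommutativeRing.ring ℤᵥ)
    using (-‿involutive; -‿injective; -0#≈0#; ⁻¹-anti-homo‿-; -‿+-comm; -‿distribˡ-*; -‿distribʳ-*;
           x∙y⁻¹≈ε⇒x≈y; +-identityʳ-unique; +-inverseʳ-unique)

  []-∸ : ∀ {m n} → n ℕ.≤ m → [ m ℕ.∸ n ] ≡ [ m ] -ᵥ [ n ]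
  []-∸ {m} {n} n≤m = sym (begin
    [ m ] -ᵥ [ n ]                   ≡⟨ cong (λ x → [ x ] -ᵥ [ n ]) (ℕ.m∸n+n≡m n≤m) ⟨
    [ m ℕ.∸ n ℕ.+ n ] -ᵥ [ n ]       ≡⟨ cong (_-ᵥ [ n ]) ([]-+ (m ℕ.∸ n) n) ⟩
    [ m ℕ.∸ n ] +ᵥ [ n ] -ᵥ [ n ]    ≡⟨ +-assoc [ m ℕ.∸ n ] [ n ] (-ᵥ [ n ]) ⟩
    [ m ℕ.∸ n ] +ᵥ ([ n ] -ᵥ [ n ])  ≡⟨ cong ([ m ℕ.∸ n ] +ᵥ_) (-‿inverseʳ [ n ]) ⟩
    [ m ℕ.∸ n ] +ᵥ 0ᵥ                ≡⟨ +-identityʳ [ m ℕ.∸ n ] ⟩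
    [ m ℕ.∸ n ]                      ∎)
    where open ≡-Reasoning

  -- The ring solver normalises with integer coefficients, interpreted in ℤ_v along ⟪_⟫.
  ⟪_⟫ : ℤ → Fin v
  ⟪ + n ⟫      = [ n ]
  ⟪ -[1+ n ] ⟫ = -ᵥ [ suc n ]

  ⟪⟫-neg : ∀ i → ⟪ ℤ.- i ⟫ ≡ -ᵥ ⟪ i ⟫
  ⟪⟫-neg (+ zero)  = sym -0#≈0#
  ⟪⟫-neg (+ suc n) = refl
  ⟪⟫-neg -[1+ n ]  = sym (-‿involutive _)

  ⟪⟫-⊖ : ∀ m n → ⟪ m ⊖ n ⟫ ≡ [ m ] -ᵥ [ n ]
  ⟪⟫-⊖ m n with ℕ.≤-total n m
  ... | inj₁ n≤m = trans (cong ⟪_⟫ (ℤ.⊖-≥ n≤m)) ([]-∸ n≤m)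
  ... | inj₂ m≤n = begin
    ⟪ m ⊖ n ⟫                  ≡⟨ cong ⟪_⟫ (ℤ.⊖-≤ m≤n) ⟩
    ⟪ ℤ.- (+ (n ℕ.∸ m)) ⟫      ≡⟨ ⟪⟫-neg (+ (n ℕ.∸ m)) ⟩
    -ᵥ [ n ℕ.∸ m ]             ≡⟨ cong (-ᵥ_) ([]-∸ m≤n) ⟩
    -ᵥ ([ n ] -ᵥ [ m ])        ≡⟨ ⁻¹-anti-homo‿- [ n ] [ m ] ⟩
    [ m ] -ᵥ [ n ]             ∎
    where open ≡-Reasoning

  ⟪⟫-+ : ∀ i j → ⟪ i ℤ.+ j ⟫ ≡ ⟪ i ⟫ +ᵥ ⟪ j ⟫
  ⟪⟫-+ (+ m)    (+ n)    = []-+ m n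
  ⟪⟫-+ (+ m)    -[1+ n ] = ⟪⟫-⊖ m (suc n)
  ⟪⟫-+ -[1+ m ] (+ n)    = trans (⟪⟫-⊖ n (suc m)) (+ᵥ-comm [ n ] (-ᵥ [ suc m ]))
  ⟪⟫-+ -[1+ m ] -[1+ n ] = begin
    -ᵥ [ suc (suc (m ℕ.+ n)) ]            ≡⟨ cong (λ x → -ᵥ [ suc x ]) (ℕ.+-suc m n) ⟨
    -ᵥ [ suc m ℕ.+ suc n ]                ≡⟨ cong (-ᵥ_) ([]-+ (suc m) (suc n)) ⟩
    -ᵥ ([ suc m ] +ᵥ [ suc n ])           ≡⟨ -‿+-comm [ suc m ] [ suc n ] ⟨
    -ᵥ [ suc m ] +ᵥ -ᵥ [ suc n ]          ∎
    where open ≡-Reasoning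

  ⟪⟫-◃ : ∀ n → ⟪ Sign.- ℤ.◃ n ⟫ ≡ -ᵥ [ n ]
  ⟪⟫-◃ zero    = sym -0#≈0#
  ⟪⟫-◃ (suc n) = refl

  ⟪⟫-* : ∀ i j → ⟪ i ℤ.* j ⟫ ≡ ⟪ i ⟫ *ᵥ ⟪ j ⟫
  ⟪⟫-* (+ zero)  j        = trans (cong ⟪_⟫ (ℤ.*-zeroˡ j)) (sym (zeroˡ ⟪ j ⟫))
  ⟪⟫-* (+ suc m) (+ zero) = trans (cong ⟪_⟫ (ℤ.*-zeroʳ (+ suc m))) (sym (zeroʳ [ suc m ]))
  ⟪⟫-* (+ suc m) (+ suc n) = []-* (suc m) (suc n)
  ⟪⟫-* (+ suc m) -[1+ n ] =
    trans (⟪⟫-◃ (suc m ℕ.* suc n)) (trans (cong (-ᵥ_) ([]-* (suc m) (suc n))) (-‿distribʳ-* [ suc m ] [ suc n ]))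
  ⟪⟫-* -[1+ m ] (+ zero)  = trans (cong ⟪_⟫ (ℤ.*-zeroʳ -[1+ m ])) (sym (zeroʳ (-ᵥ [ suc m ])))
  ⟪⟫-* -[1+ m ] (+ suc n) =
    trans (⟪⟫-◃ (suc m ℕ.* suc n)) (trans (cong (-ᵥ_) ([]-* (suc m) (suc n))) (-‿distribˡ-* [ suc m ] [ suc n ]))
  ⟪⟫-* -[1+ m ] -[1+ n ]  = begin
    [ suc m ℕ.* suc n ]                   ≡⟨ []-* (suc m) (suc n) ⟩
    [ suc m ] *ᵥ [ suc n ]                ≡⟨ -‿involutive _ ⟨
    -ᵥ -ᵥ ([ suc m ] *ᵥ [ suc n ])        ≡⟨ cong (-ᵥ_) (-‿distribʳ-* [ suc m ] [ suc n ]) ⟩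
    -ᵥ ([ suc m ] *ᵥ -ᵥ [ suc n ])        ≡⟨ -‿distribˡ-* [ suc m ] (-ᵥ [ suc n ]) ⟩
    -ᵥ [ suc m ] *ᵥ -ᵥ [ suc n ]          ∎
    where open ≡-Reasoning

  ⟪⟫-morphism : ℤ.+-*-rawRing -Raw-AlmostCommutative⟶ fromCommutativeRing ℤᵥ
  ⟪⟫-morphism = record
    { ⟦_⟧ = ⟪_⟫ ; +-homo = ⟪⟫-+ ; *-homo = ⟪⟫-* ; -‿homo = ⟪⟫-neg ; 0-homo = refl ; 1-homo = refl }

  private
    _≟⟪⟫_ : ∀ i j → Maybe (⟪ i ⟫ ≡ ⟪ j ⟫)
    i ≟⟪⟫ j with i ℤ.≟ j
    ... | yes refl = just refl
    ... | no _     = nothing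

  open RingSolver ℤ.+-*-rawRing (fromCommutativeRing ℤᵥ) ⟪⟫-morphism _≟⟪⟫_ public
    using (solve; _:=_; _:+_; _:*_; :-_; _:-_; con)

  unit-inverse-unique : ∀ {a m m′} → a *ᵥ m ≡ 1ᵥ → a *ᵥ m′ ≡ 1ᵥ → m ≡ m′
  unit-inverse-unique {a} {m} {m′} am≡1 am′≡1 = begin
    m                ≡⟨ *-identityʳ m ⟨
    m *ᵥ 1ᵥ          ≡⟨ cong (m *ᵥ_) am′≡1 ⟨
    m *ᵥ (a *ᵥ m′)   ≡⟨ solve 3 (λ a m m′ → m :* (a :* m′) := (a :* m) :* m′) refl a m m′ ⟩
    (a *ᵥ m) *ᵥ m′   ≡⟨ cong (_*ᵥ m′) am≡1 ⟩
    1ᵥ *ᵥ m′         ≡⟨ *ᵥ-identityˡ m′ ⟩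
    m′               ∎
    where open ≡-Reasoning

  IsUnit-irrelevant : ∀ {a} → Irrelevant (IsUnit v a)
  IsUnit-irrelevant {a} (m , p) (m′ , p′) = pair-≡ (unit-inverse-unique {a} p p′) p p′
    where
    pair-≡ : ∀ {m m′} → m ≡ m′ → (p : a *ᵥ m ≡ 1ᵥ) (p′ : a *ᵥ m′ ≡ 1ᵥ) →
             _≡_ {A = IsUnit v a} (m , p) (m′ , p′)
    pair-≡ refl p p′ = cong (_ ,_) (Decidable⇒UIP.≡-irrelevant _≟_ p p′)

  ℤ* : Set
  ℤ* = Σ (Fin v) (IsUnit v)

  ℤ*-≡ : {a b : ℤ*} → proj₁ a ≡ proj₁ b → a ≡ b
  ℤ*-≡ {a , p} {.a , q} refl = cong (a ,_) (IsUnit-irrelevant {a} p q)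

  infixl 7 _·_
  infix 8 _⁻¹

  IsUnit-* : ∀ {a b} → IsUnit v a → IsUnit v b → IsUnit v (a *ᵥ b)
  IsUnit-* {a} {b} (m , am≡1) (n , bn≡1) = n *ᵥ m , (begin
    (a *ᵥ b) *ᵥ (n *ᵥ m)   ≡⟨ solve 4 (λ a b n m → (a :* b) :* (n :* m) := (a :* m) :* (b :* n)) refl a b n m ⟩
    (a *ᵥ m) *ᵥ (b *ᵥ n)   ≡⟨ cong₂ _*ᵥ_ am≡1 bn≡1 ⟩
    1ᵥ *ᵥ 1ᵥ               ≡⟨ *ᵥ-identityˡ 1ᵥ ⟩
    1ᵥ                     ∎)
    where open ≡-Reasoning

  -- Opaque, like the later proof-carrying definitions: unfolding them during unification exposes
  -- arithmetic modulo v under metavariables, and type checking then blows up.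
  opaque
    _·_ : ℤ* → ℤ* → ℤ*
    (a , a-unit) · (b , b-unit) = a *ᵥ b , IsUnit-* {a} {b} a-unit b-unit

    _⁻¹ : ℤ* → ℤ*
    (a , m , am≡1) ⁻¹ = m , a , trans (*ᵥ-comm m a) am≡1

    proj₁-· : ∀ a b → proj₁ (a · b) ≡ proj₁ a *ᵥ proj₁ b
    proj₁-· _ _ = refl

    ⁻¹-inverseˡ : ∀ a → proj₁ (a ⁻¹) *ᵥ proj₁ a ≡ 1ᵥ
    ⁻¹-inverseˡ (a , m , am≡1) = trans (*ᵥ-comm m a) am≡1

    ⁻¹-inverseʳ : ∀ a → proj₁ a *ᵥ proj₁ (a ⁻¹) ≡ 1ᵥ
    ⁻¹-inverseʳ (a , m , am≡1) = am≡1

  x·y·y⁻¹≡x : ∀ x y → x · y · y ⁻¹ ≡ x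
  x·y·y⁻¹≡x x y = ℤ*-≡ (begin
    proj₁ (x · y · y ⁻¹)                  ≡⟨ proj₁-· (x · y) (y ⁻¹) ⟩
    proj₁ (x · y) *ᵥ proj₁ (y ⁻¹)         ≡⟨ cong (_*ᵥ proj₁ (y ⁻¹)) (proj₁-· x y) ⟩
    proj₁ x *ᵥ proj₁ y *ᵥ proj₁ (y ⁻¹)    ≡⟨ *ᵥ-assoc (proj₁ x) (proj₁ y) _ ⟩
    proj₁ x *ᵥ (proj₁ y *ᵥ proj₁ (y ⁻¹))  ≡⟨ cong (proj₁ x *ᵥ_) (⁻¹-inverseʳ y) ⟩
    proj₁ x *ᵥ 1ᵥ                         ≡⟨ *-identityʳ (proj₁ x) ⟩
    proj₁ x                               ∎)
    where open ≡-Reasoning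

  x·y⁻¹·y≡x : ∀ x y → x · y ⁻¹ · y ≡ x
  x·y⁻¹·y≡x x y = ℤ*-≡ (begin
    proj₁ (x · y ⁻¹ · y)                  ≡⟨ proj₁-· (x · y ⁻¹) y ⟩
    proj₁ (x · y ⁻¹) *ᵥ proj₁ y           ≡⟨ cong (_*ᵥ proj₁ y) (proj₁-· x (y ⁻¹)) ⟩
    proj₁ x *ᵥ proj₁ (y ⁻¹) *ᵥ proj₁ y    ≡⟨ *ᵥ-assoc (proj₁ x) (proj₁ (y ⁻¹)) _ ⟩
    proj₁ x *ᵥ (proj₁ (y ⁻¹) *ᵥ proj₁ y)  ≡⟨ cong (proj₁ x *ᵥ_) (⁻¹-inverseˡ y) ⟩
    proj₁ x *ᵥ 1ᵥ                         ≡⟨ *-identityʳ (proj₁ x) ⟩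
    proj₁ x                               ∎)
    where open ≡-Reasoning

  ∈-affImage⁺ : ∀ a b {x y X} → x ∈ X → a *ᵥ x +ᵥ b ≡ y → y ∈ affImage v a b X
  ∈-affImage⁺ a b {x} {X = X} x∈X eq =
    ∈-tabulate⁺ (λ y → any? λ x → (x ∈? X) ×-dec ((a *ᵥ x +ᵥ b) ≟ y)) (x , x∈X , eq)

  ∈-affImage⁻ : ∀ a b X {y} → y ∈ affImage v a b X → ∃ λ x → x ∈ X × a *ᵥ x +ᵥ b ≡ y
  ∈-affImage⁻ a b X = ∈-tabulate⁻ (λ y → any? λ x → (x ∈? X) ×-dec ((a *ᵥ x +ᵥ b) ≟ y))

  ∈-diffSet⁺ : ∀ {x₁ x₂ d X} → x₁ ∈ X → x₂ ∈ X → x₁ -ᵥ x₂ ≡ d → d ∈ diffSet v X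
  ∈-diffSet⁺ {x₁} {x₂} {X = X} x₁∈X x₂∈X eq =
    ∈-tabulate⁺ (λ d → any? λ x₁ → any? λ x₂ → (x₁ ∈? X) ×-dec ((x₂ ∈? X) ×-dec ((x₁ -ᵥ x₂) ≟ d)))
      (x₁ , x₂ , x₁∈X , x₂∈X , eq)

  ∈-diffSet⁻ : ∀ X {d} → d ∈ diffSet v X → ∃₂ λ x₁ x₂ → x₁ ∈ X × x₂ ∈ X × x₁ -ᵥ x₂ ≡ d
  ∈-diffSet⁻ X =
    ∈-tabulate⁻ (λ d → any? λ x₁ → any? λ x₂ → (x₁ ∈? X) ×-dec ((x₂ ∈? X) ×-dec ((x₁ -ᵥ x₂) ≟ d)))

  unit-cancel : ∀ {a m x y} → m *ᵥ a ≡ 1ᵥ → a *ᵥ x ≡ a *ᵥ y → x ≡ y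
  unit-cancel {a} {m} {x} {y} ma≡1 ax≡ay = begin
    x                ≡⟨ *ᵥ-identityˡ x ⟨
    1ᵥ *ᵥ x          ≡⟨ cong (_*ᵥ x) ma≡1 ⟨
    (m *ᵥ a) *ᵥ x    ≡⟨ *ᵥ-assoc m a x ⟩
    m *ᵥ (a *ᵥ x)    ≡⟨ cong (m *ᵥ_) ax≡ay ⟩
    m *ᵥ (a *ᵥ y)    ≡⟨ *ᵥ-assoc m a y ⟨
    (m *ᵥ a) *ᵥ y    ≡⟨ cong (_*ᵥ y) ma≡1 ⟩
    1ᵥ *ᵥ y          ≡⟨ *ᵥ-identityˡ y ⟩
    y                ∎
    where open ≡-Reasoning

  a[r₀-[r₀-mx]]≡x : ∀ a m r₀ x → a *ᵥ m ≡ 1ᵥ → a *ᵥ (r₀ -ᵥ (r₀ -ᵥ m *ᵥ x)) ≡ x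
  a[r₀-[r₀-mx]]≡x a m r₀ x am≡1 = begin
    a *ᵥ (r₀ -ᵥ (r₀ -ᵥ m *ᵥ x))
      ≡⟨ solve 4 (λ a m r₀ x → a :* (r₀ :- (r₀ :- m :* x)) := (a :* m) :* x) refl a m r₀ x ⟩
    (a *ᵥ m) *ᵥ x    ≡⟨ cong (_*ᵥ x) am≡1 ⟩
    1ᵥ *ᵥ x          ≡⟨ *ᵥ-identityˡ x ⟩
    x                ∎
    where open ≡-Reasoning

  r₀-m[a[r₀-r]]≡r : ∀ a m r₀ r → m *ᵥ a ≡ 1ᵥ → r₀ -ᵥ m *ᵥ (a *ᵥ (r₀ -ᵥ r)) ≡ r
  r₀-m[a[r₀-r]]≡r a m r₀ r ma≡1 = begin
    r₀ -ᵥ m *ᵥ (a *ᵥ (r₀ -ᵥ r))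
      ≡⟨ solve 4 (λ a m r₀ r → r₀ :- m :* (a :* (r₀ :- r)) := r₀ :- (m :* a) :* (r₀ :- r)) refl a m r₀ r ⟩
    r₀ -ᵥ (m *ᵥ a) *ᵥ (r₀ -ᵥ r)   ≡⟨ cong (λ c → r₀ -ᵥ c *ᵥ (r₀ -ᵥ r)) ma≡1 ⟩
    r₀ -ᵥ 1ᵥ *ᵥ (r₀ -ᵥ r)         ≡⟨ solve 2 (λ r₀ r → r₀ :- con (+ 1) :* (r₀ :- r) := r) refl r₀ r ⟩
    r                             ∎
    where open ≡-Reasoning

  affImage-∘ : ∀ a b c d X → affImage v a b (affImage v c d X) ≡ affImage v (a *ᵥ c) (a *ᵥ d +ᵥ b) X
  affImage-∘ a b c d X = ⊆-antisym ⊆→ ⊆←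
    where
    compose : ∀ x → a *ᵥ (c *ᵥ x +ᵥ d) +ᵥ b ≡ (a *ᵥ c) *ᵥ x +ᵥ (a *ᵥ d +ᵥ b)
    compose = solve 5 (λ a b c d x → a :* (c :* x :+ d) :+ b := (a :* c) :* x :+ (a :* d :+ b)) refl a b c d
    ⊆→ : affImage v a b (affImage v c d X) ⊆ affImage v (a *ᵥ c) (a *ᵥ d +ᵥ b) X
    ⊆→ y∈ with ∈-affImage⁻ a b (affImage v c d X) y∈
    ... | z , z∈ , az+b≡y with ∈-affImage⁻ c d X z∈
    ... | x , x∈ , cx+d≡z = ∈-affImage⁺ (a *ᵥ c) (a *ᵥ d +ᵥ b) x∈
      (trans (sym (compose x)) (trans (cong (λ w → a *ᵥ w +ᵥ b) cx+d≡z) az+b≡y))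
    ⊆← : affImage v (a *ᵥ c) (a *ᵥ d +ᵥ b) X ⊆ affImage v a b (affImage v c d X)
    ⊆← y∈ with ∈-affImage⁻ (a *ᵥ c) (a *ᵥ d +ᵥ b) X y∈
    ... | x , x∈ , eq = ∈-affImage⁺ a b (∈-affImage⁺ c d x∈ refl) (trans (compose x) eq)

  affImage-identity : ∀ X → affImage v 1ᵥ 0ᵥ X ≡ X
  affImage-identity X = ⊆-antisym ⊆→ (λ x∈ → ∈-affImage⁺ 1ᵥ 0ᵥ x∈ (identity _))
    where
    identity : ∀ x → 1ᵥ *ᵥ x +ᵥ 0ᵥ ≡ x
    identity x = trans (+-identityʳ _) (*ᵥ-identityˡ x)
    ⊆→ : affImage v 1ᵥ 0ᵥ X ⊆ X
    ⊆→ y∈ with ∈-affImage⁻ 1ᵥ 0ᵥ X y∈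
    ... | x , x∈ , eq = subst (_∈ X) (trans (sym (identity x)) eq) x∈

  affImage-inverse : ∀ a m b X → m *ᵥ a ≡ 1ᵥ → affImage v m (-ᵥ (m *ᵥ b)) (affImage v a b X) ≡ X
  affImage-inverse a m b X ma≡1 = begin
    affImage v m (-ᵥ (m *ᵥ b)) (affImage v a b X)        ≡⟨ affImage-∘ m (-ᵥ (m *ᵥ b)) a b X ⟩
    affImage v (m *ᵥ a) (m *ᵥ b +ᵥ -ᵥ (m *ᵥ b)) X
      ≡⟨ cong₂ (λ c d → affImage v c d X) ma≡1 (-‿inverseʳ (m *ᵥ b)) ⟩
    affImage v 1ᵥ 0ᵥ X                                  ≡⟨ affImage-identity X ⟩
    X                                                   ∎
    where open ≡-Reasoning

  translate : Fin v → Subset v → Subset v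
  translate t = affImage v 1ᵥ t

  scale : Fin v → Subset v → Subset v
  scale l = affImage v l 0ᵥ

  dilation : Fin v → Fin v → Subset v → Subset v
  dilation a r = affImage v a (-ᵥ (a *ᵥ r))

  translate-∘ : ∀ s t X → translate s (translate t X) ≡ translate (t +ᵥ s) X
  translate-∘ s t X = trans (affImage-∘ 1ᵥ s 1ᵥ t X)
    (cong₂ (λ c d → affImage v c d X) (*ᵥ-identityˡ 1ᵥ) (cong (_+ᵥ s) (*ᵥ-identityˡ t)))

  translate-injective : ∀ t {X X′} → translate t X ≡ translate t X′ → X ≡ X′
  translate-injective t {X} {X′} eq = begin
    X                                                   ≡⟨ affImage-inverse 1ᵥ 1ᵥ t X (*ᵥ-identityˡ 1ᵥ) ⟨
    affImage v 1ᵥ (-ᵥ (1ᵥ *ᵥ t)) (translate t X)        ≡⟨ cong (affImage v 1ᵥ (-ᵥ (1ᵥ *ᵥ t))) eq ⟩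
    affImage v 1ᵥ (-ᵥ (1ᵥ *ᵥ t)) (translate t X′)       ≡⟨ affImage-inverse 1ᵥ 1ᵥ t X′ (*ᵥ-identityˡ 1ᵥ) ⟩
    X′                                                  ∎
    where open ≡-Reasoning

  scale-dilation : ∀ l a r Y → scale l (dilation a r Y) ≡ dilation (l *ᵥ a) r Y
  scale-dilation l a r Y = trans (affImage-∘ l 0ᵥ a (-ᵥ (a *ᵥ r)) Y)
    (cong (λ d → affImage v (l *ᵥ a) d Y)
      (solve 3 (λ l a r → l :* (:- (a :* r)) :+ con (+ 0) := :- ((l :* a) :* r)) refl l a r))

  translate-dilation : ∀ a r s Y → translate (-ᵥ (a *ᵥ (s -ᵥ r))) (dilation a r Y) ≡ dilation a s Y
  translate-dilation a r s Y = trans (affImage-∘ 1ᵥ (-ᵥ (a *ᵥ (s -ᵥ r))) a (-ᵥ (a *ᵥ r)) Y)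
    (cong₂ (λ c d → affImage v c d Y) (*ᵥ-identityˡ a)
      (solve 3 (λ a r s → con (+ 1) :* (:- (a :* r)) :+ :- (a :* (s :- r)) := :- (a :* s)) refl a r s))

  ∈-dilation : ∀ a r {s Y} → s ∈ Y → a *ᵥ (s -ᵥ r) ∈ dilation a r Y
  ∈-dilation a r {s} s∈Y =
    ∈-affImage⁺ a (-ᵥ (a *ᵥ r)) s∈Y (solve 3 (λ a r s → a :* s :+ :- (a :* r) := a :* (s :- r)) refl a r s)

  0∈dilation⁺ : ∀ a {r Y} → r ∈ Y → 0ᵥ ∈ dilation a r Y
  0∈dilation⁺ a {r} r∈Y = ∈-affImage⁺ a (-ᵥ (a *ᵥ r)) r∈Y (-‿inverseʳ (a *ᵥ r))

  0∈dilation⁻ : ∀ a r Y → IsUnit v a → 0ᵥ ∈ dilation a r Y → r ∈ Y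
  0∈dilation⁻ a r Y (m , am≡1) 0∈ with ∈-affImage⁻ a (-ᵥ (a *ᵥ r)) Y 0∈
  ... | s , s∈Y , as-ar≡0 =
    subst (_∈ Y) (unit-cancel {a} {m} (trans (*ᵥ-comm m a) am≡1) (x∙y⁻¹≈ε⇒x≈y _ _ as-ar≡0)) s∈Y

  Elem-affImage↔ : ∀ a b X → IsUnit v a → Elem X ↔ Elem (affImage v a b X)
  Elem-affImage↔ a b X (m , am≡1) = mk↔ₛ′ to from (λ _ → Elem-≡ (to∘from _)) (λ _ → Elem-≡ (from∘to _))
    where
    ma≡1 : m *ᵥ a ≡ 1ᵥ
    ma≡1 = trans (*ᵥ-comm m a) am≡1
    to : Elem X → Elem (affImage v a b X)
    to (x , x∈) = a *ᵥ x +ᵥ b , ∈-affImage⁺ a b x∈ refl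
    from : Elem (affImage v a b X) → Elem X
    from (y , y∈) = m *ᵥ y +ᵥ -ᵥ (m *ᵥ b) ,
      subst (_ ∈_) (affImage-inverse a m b X ma≡1) (∈-affImage⁺ m (-ᵥ (m *ᵥ b)) y∈ refl)
    to∘from : ∀ y → a *ᵥ (m *ᵥ y +ᵥ -ᵥ (m *ᵥ b)) +ᵥ b ≡ y
    to∘from y = begin
      a *ᵥ (m *ᵥ y +ᵥ -ᵥ (m *ᵥ b)) +ᵥ b
        ≡⟨ solve 4 (λ a m b y → a :* (m :* y :+ :- (m :* b)) :+ b := (a :* m) :* (y :- b) :+ b) refl a m b y ⟩
      (a *ᵥ m) *ᵥ (y -ᵥ b) +ᵥ b     ≡⟨ cong (λ c → c *ᵥ (y -ᵥ b) +ᵥ b) am≡1 ⟩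
      1ᵥ *ᵥ (y -ᵥ b) +ᵥ b           ≡⟨ solve 2 (λ b y → con (+ 1) :* (y :- b) :+ b := y) refl b y ⟩
      y                             ∎
      where open ≡-Reasoning
    from∘to : ∀ x → m *ᵥ (a *ᵥ x +ᵥ b) +ᵥ -ᵥ (m *ᵥ b) ≡ x
    from∘to x = begin
      m *ᵥ (a *ᵥ x +ᵥ b) +ᵥ -ᵥ (m *ᵥ b)
        ≡⟨ solve 4 (λ a m b x → m :* (a :* x :+ b) :+ :- (m :* b) := (m :* a) :* x) refl a m b x ⟩
      (m *ᵥ a) *ᵥ x                 ≡⟨ cong (_*ᵥ x) ma≡1 ⟩
      1ᵥ *ᵥ x                       ≡⟨ *ᵥ-identityˡ x ⟩
      x                             ∎
      where open ≡-Reasoning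

  ∣affImage∣ : ∀ a b X → IsUnit v a → ∣ affImage v a b X ∣ ≡ ∣ X ∣
  ∣affImage∣ a b X a-unit =
    ↔⇒≡ (↔-trans (Fin∣∣↔Elem _) (↔-trans (↔-sym (Elem-affImage↔ a b X a-unit)) (↔-sym (Fin∣∣↔Elem X))))

  diffSet-affImage : ∀ a b X → diffSet v (affImage v a b X) ≡ scale a (diffSet v X)
  diffSet-affImage a b X = ⊆-antisym ⊆→ ⊆←
    where
    difference : ∀ x₁ x₂ → a *ᵥ (x₁ -ᵥ x₂) +ᵥ 0ᵥ ≡ (a *ᵥ x₁ +ᵥ b) -ᵥ (a *ᵥ x₂ +ᵥ b)
    difference = solve 4 (λ a b x₁ x₂ → a :* (x₁ :- x₂) :+ con (+ 0) := (a :* x₁ :+ b) :- (a :* x₂ :+ b)) refl a b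
    ⊆→ : diffSet v (affImage v a b X) ⊆ scale a (diffSet v X)
    ⊆→ d∈ with ∈-diffSet⁻ (affImage v a b X) d∈
    ... | y₁ , y₂ , y₁∈ , y₂∈ , y₁-y₂≡d with ∈-affImage⁻ a b X y₁∈ | ∈-affImage⁻ a b X y₂∈
    ... | x₁ , x₁∈ , ax₁+b≡y₁ | x₂ , x₂∈ , ax₂+b≡y₂ = ∈-affImage⁺ a 0ᵥ (∈-diffSet⁺ x₁∈ x₂∈ refl)
      (trans (difference x₁ x₂) (trans (cong₂ _-ᵥ_ ax₁+b≡y₁ ax₂+b≡y₂) y₁-y₂≡d))
    ⊆← : scale a (diffSet v X) ⊆ diffSet v (affImage v a b X)
    ⊆← d∈ with ∈-affImage⁻ a 0ᵥ (diffSet v X) d∈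
    ... | z , z∈ , az+0≡d with ∈-diffSet⁻ X z∈
    ... | x₁ , x₂ , x₁∈ , x₂∈ , x₁-x₂≡z =
      ∈-diffSet⁺ (∈-affImage⁺ a b x₁∈ refl) (∈-affImage⁺ a b x₂∈ refl)
        (trans (sym (difference x₁ x₂)) (trans (cong (λ z → a *ᵥ z +ᵥ 0ᵥ) x₁-x₂≡z) az+0≡d))

  InSubgroupGen-scale : ∀ a {D z} → InSubgroupGen v D z → InSubgroupGen v (scale a D) (a *ᵥ z)
  InSubgroupGen-scale a gen-zero = subst (InSubgroupGen v _) (sym (zeroʳ a)) gen-zero
  InSubgroupGen-scale a (gen-elem z∈) = gen-elem (∈-affImage⁺ a 0ᵥ z∈ (+-identityʳ (a *ᵥ _)))
  InSubgroupGen-scale a (gen-neg {z} g) =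
    subst (InSubgroupGen v _) (-‿distribʳ-* a z) (gen-neg (InSubgroupGen-scale a g))
  InSubgroupGen-scale a (gen-add {y} {z} g h) =
    subst (InSubgroupGen v _) (sym (*ᵥ-distribˡ-+ᵥ a y z)) (gen-add (InSubgroupGen-scale a g) (InSubgroupGen-scale a h))

  GeneratesAll-scale : ∀ a {D} → IsUnit v a → GeneratesAll v D → GeneratesAll v (scale a D)
  GeneratesAll-scale a (m , am≡1) gen y = subst (InSubgroupGen v _) a[my]≡y (InSubgroupGen-scale a (gen (m *ᵥ y)))
    where
    a[my]≡y : a *ᵥ (m *ᵥ y) ≡ y
    a[my]≡y = trans (sym (*ᵥ-assoc a m y)) (trans (cong (_*ᵥ y) am≡1) (*ᵥ-identityˡ y))

  InBcon-affImage : ∀ {k} a b {X} → IsUnit v a → InBcon v k X → InBcon v k (affImage v a b X)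
  InBcon-affImage a b {X} a-unit ((∣X∣≡k , ∣D∣≡k²-k+1) , gen) =
    ( trans (∣affImage∣ a b X a-unit) ∣X∣≡k
    , trans (cong ∣_∣ (diffSet-affImage a b X)) (trans (∣affImage∣ a 0ᵥ (diffSet v X) a-unit) ∣D∣≡k²-k+1) )
    , subst (GeneratesAll v) (sym (diffSet-affImage a b X)) (GeneratesAll-scale a a-unit gen)

  AffEquiv-trans : ∀ {X Y W} → AffEquiv v X Y → AffEquiv v Y W → AffEquiv v X W
  AffEquiv-trans {X} (a , a-unit , b , Y≡aX+b) (c , c-unit , d , W≡cY+d) =
    c *ᵥ a , IsUnit-* {c} {a} c-unit a-unit , c *ᵥ b +ᵥ d ,
    trans W≡cY+d (trans (cong (affImage v c d) Y≡aX+b) (affImage-∘ c d a b X))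

  -- Sets with k² − k + 1 differences

  module DifferenceCount {k′} (X : Subset v) (∣X∣≡1+k′ : ∣ X ∣ ≡ suc k′) where

    enumeration : Fin (suc k′) ↔ Elem X
    enumeration = subst (λ n → Fin n ↔ Elem X) ∣X∣≡1+k′ (Fin∣∣↔Elem X)

    open Inverse enumeration using (to; from; strictlyInverseˡ)

    elem : Fin (suc k′) → Fin v
    elem i = proj₁ (to i)

    index : ∀ {x} → x ∈ X → Fin (suc k′)
    index x∈ = from (_ , x∈)

    elem-index : ∀ {x} (x∈ : x ∈ X) → elem (index x∈) ≡ x
    elem-index x∈ = cong proj₁ (strictlyInverseˡ (_ , x∈))

    index-injective : ∀ {x y} (x∈ : x ∈ X) (y∈ : y ∈ X) → index x∈ ≡ index y∈ → x ≡ y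
    index-injective x∈ y∈ eq = trans (sym (elem-index x∈)) (trans (cong elem eq) (elem-index y∈))

    pairDifference : Fin (suc k′) × Fin k′ → Fin v
    pairDifference (i , j) = elem i -ᵥ elem (punchIn i j)

    -- 0 stands for the diagonal pairs, suc c for the pair (i , punchIn i j) with (i , j) = remQuot k′ c.
    difference : Fin (suc (suc k′ ℕ.* k′)) → Elem (diffSet v X)
    difference Fin.zero    = 0ᵥ , ∈-diffSet⁺ (proj₂ (to Fin.zero)) (proj₂ (to Fin.zero)) (-‿inverseʳ _)
    difference (Fin.suc c) = pairDifference (remQuot k′ c) , ∈-diffSet⁺ (proj₂ (to _)) (proj₂ (to _)) refl

    code : ∀ {x₁ x₂} (x₁∈ : x₁ ∈ X) (x₂∈ : x₂ ∈ X) → index x₁∈ ≢ index x₂∈ →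
           Fin (suc (suc k′ ℕ.* k′))
    code x₁∈ x₂∈ i₁≢i₂ = Fin.suc (combine (index x₁∈) (punchOut i₁≢i₂))

    difference-code : ∀ {x₁ x₂} (x₁∈ : x₁ ∈ X) (x₂∈ : x₂ ∈ X) (i₁≢i₂ : index x₁∈ ≢ index x₂∈) →
      proj₁ (difference (code x₁∈ x₂∈ i₁≢i₂)) ≡ x₁ -ᵥ x₂
    difference-code x₁∈ x₂∈ i₁≢i₂ = trans (cong pairDifference (remQuot-combine _ _))
      (cong₂ _-ᵥ_ (elem-index x₁∈) (trans (cong elem (punchIn-punchOut i₁≢i₂)) (elem-index x₂∈)))

    difference-surjective : ∀ d → ∃ λ c → difference c ≡ d
    difference-surjective (d , d∈) with ∈-diffSet⁻ X d∈
    ... | x₁ , x₂ , x₁∈ , x₂∈ , refl with index x₁∈ ≟ index x₂∈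
    ... | yes i₁≡i₂ =
      Fin.zero , Elem-≡ (sym (trans (cong (_-ᵥ x₂) (index-injective x₁∈ x₂∈ i₁≡i₂)) (-‿inverseʳ x₂)))
    ... | no i₁≢i₂  = code x₁∈ x₂∈ i₁≢i₂ , Elem-≡ (difference-code x₁∈ x₂∈ i₁≢i₂)

  1+k′²-[1+k′]+1≡1+[1+k′]k′ : ∀ k′ → suc k′ ℕ.* suc k′ ℕ.∸ suc k′ ℕ.+ 1 ≡ suc (suc k′ ℕ.* k′)
  1+k′²-[1+k′]+1≡1+[1+k′]k′ k′ = begin
    suc k′ ℕ.* suc k′ ℕ.∸ suc k′ ℕ.+ 1  ≡⟨ cong (ℕ._+ 1) (ℕ.m+n∸m≡n (suc k′) (k′ ℕ.* suc k′)) ⟩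
    k′ ℕ.* suc k′ ℕ.+ 1                 ≡⟨ ℕ.+-comm (k′ ℕ.* suc k′) 1 ⟩
    suc (k′ ℕ.* suc k′)                 ≡⟨ cong suc (ℕ.*-comm k′ (suc k′)) ⟩
    suc (suc k′ ℕ.* k′)                 ∎
    where open ≡-Reasoning

  -- The k(k − 1) differences of distinct pairs cover the k² − k nonzero elements of X − X, so none repeats.
  distinct-differences : ∀ {k X x₁ x₂ y₁ y₂} → InB v k X → x₁ ∈ X → x₂ ∈ X → y₁ ∈ X → y₂ ∈ X →
    x₁ ≢ x₂ → x₁ -ᵥ x₂ ≡ y₁ -ᵥ y₂ → x₁ ≡ y₁
  distinct-differences {zero} {X} (∣X∣≡0 , _) x₁∈ _ _ _ _ _
    with subst Fin ∣X∣≡0 (Inverse.from (Fin∣∣↔Elem X) (_ , x₁∈))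
  ... | ()
  distinct-differences {suc k′} {X} {x₁} {x₂} {y₁} {y₂} (∣X∣≡1+k′ , ∣D∣≡) x₁∈ x₂∈ y₁∈ y₂∈ x₁≢x₂ x₁-x₂≡y₁-y₂
    with x₁ ≟ y₁
  ... | yes x₁≡y₁ = x₁≡y₁
  ... | no x₁≢y₁  = contradiction
    (surjective-collision⇒≤ difference differences difference-surjective c₁≢c₂
      (Elem-≡ (trans (difference-code x₁∈ x₂∈ i₁≢i₂) (trans x₁-x₂≡y₁-y₂ (sym (difference-code y₁∈ y₂∈ j₁≢j₂))))))
    (ℕ.n≮n _)
    where
    open DifferenceCount X ∣X∣≡1+k′
    differences : Fin (suc (suc k′ ℕ.* k′)) ↔ Elem (diffSet v X)
    differences = subst (λ n → Fin n ↔ Elem (diffSet v X)) (trans ∣D∣≡ (1+k′²-[1+k′]+1≡1+[1+k′]k′ k′))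
      (Fin∣∣↔Elem (diffSet v X))
    i₁≢i₂ : index x₁∈ ≢ index x₂∈
    i₁≢i₂ = x₁≢x₂ ∘ index-injective x₁∈ x₂∈
    j₁≢j₂ : index y₁∈ ≢ index y₂∈
    j₁≢j₂ j₁≡j₂ = x₁≢x₂ (x∙y⁻¹≈ε⇒x≈y x₁ x₂ (trans x₁-x₂≡y₁-y₂
      (trans (cong (_-ᵥ y₂) (index-injective y₁∈ y₂∈ j₁≡j₂)) (-‿inverseʳ y₂))))
    c₁≢c₂ : code x₁∈ x₂∈ i₁≢i₂ ≢ code y₁∈ y₂∈ j₁≢j₂
    c₁≢c₂ eq = x₁≢y₁ (index-injective x₁∈ y₁∈ (combine-injectiveˡ _ _ _ _ (suc-injective eq)))

  translation-free : ∀ {k X x t} → InB v k X → x ∈ X → translate t X ≡ X → t ≡ 0ᵥ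
  translation-free {X = X} {x} {t} X∈B x∈ tX≡X with t ≟ 0ᵥ
  ... | yes t≡0 = t≡0
  ... | no t≢0  = contradiction
    (distinct-differences X∈B (shift∈ (shift∈ x∈)) (shift∈ x∈) (shift∈ x∈) x∈ x₂≢x₁
      (trans (shift-difference (x +ᵥ t)) (sym (shift-difference x))))
    x₂≢x₁
    where
    shift∈ : ∀ {y} → y ∈ X → y +ᵥ t ∈ X
    shift∈ y∈ = subst (_ ∈_) tX≡X (∈-affImage⁺ 1ᵥ t y∈ (cong (_+ᵥ t) (*ᵥ-identityˡ _)))
    shift-difference : ∀ y → y +ᵥ t -ᵥ y ≡ t
    shift-difference = solve 2 (λ t y → y :+ t :- y := t) refl t
    x₂≢x₁ : x +ᵥ t +ᵥ t ≢ x +ᵥ t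
    x₂≢x₁ = t≢0 ∘ +-identityʳ-unique (x +ᵥ t) t

  translate-unique : ∀ {k X x s t} → InB v k X → x ∈ X → translate s X ≡ translate t X → s ≡ t
  translate-unique {X = X} {s = s} {t} X∈B x∈ sX≡tX = sym (x∙y⁻¹≈ε⇒x≈y t s (translation-free X∈B x∈ [t-s]X≡X))
    where
    [t-s]X≡X : translate (t -ᵥ s) X ≡ X
    [t-s]X≡X = begin
      translate (t -ᵥ s) X               ≡⟨ translate-∘ (-ᵥ s) t X ⟨
      translate (-ᵥ s) (translate t X)   ≡⟨ cong (translate (-ᵥ s)) sX≡tX ⟨
      translate (-ᵥ s) (translate s X)   ≡⟨ translate-∘ (-ᵥ s) s X ⟩
      translate (s -ᵥ s) X               ≡⟨ cong (λ c → translate c X) (-‿inverseʳ s) ⟩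
      translate 0ᵥ X                     ≡⟨ affImage-identity X ⟩
      X                                  ∎
      where open ≡-Reasoning

  shift-unique : ∀ {k X y l x x′} → InB v k X → y ∈ X →
    scale l X ≡ translate (-ᵥ x) X → scale l X ≡ translate (-ᵥ x′) X → x ≡ x′
  shift-unique {X = X} {x = x} {x′} X∈B y∈ lX≡X-x lX≡X-x′ =
    -‿injective (translate-unique {X = X} {s = -ᵥ x} {t = -ᵥ x′} X∈B y∈ (trans (sym lX≡X-x) lX≡X-x′))

  -- Euler's function counts the units

  IsUnit⇒coprime : ∀ m → IsUnit v [ m ] → gcd m v ≡ 1
  IsUnit⇒coprime m (b , mb≡1) = ∣1⇒≡1 (∣n∣m%n⇒∣m g∣v (subst (gcd m v ∣_) mb%v≡1%v g∣mb%v))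
    where
    g∣v : gcd m v ∣ v
    g∣v = gcd[m,n]∣n m v
    g∣mb%v : gcd m v ∣ (m ℕ.* toℕ b) % v
    g∣mb%v = %-presˡ-∣ (∣m⇒∣m*n (toℕ b) (gcd[m,n]∣m m v)) g∣v
    mb%v≡1%v : (m ℕ.* toℕ b) % v ≡ 1 % v
    mb%v≡1%v = trans (sym (toℕ-[] _))
      (trans (cong toℕ (trans ([]-* m (toℕ b)) (trans (cong ([ m ] *ᵥ_) ([]-toℕ b)) mb≡1))) (toℕ-[] 1))

  coprime⇒IsUnit : ∀ m → gcd m v ≡ 1 → IsUnit v [ m ]
  coprime⇒IsUnit m gcd≡1 with Bézout.identity (subst (GCD m v) gcd≡1 (gcd-GCD m v))
  ... | Bézout.+- x y 1+yv≡xm = [ x ] , (begin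
    [ m ] *ᵥ [ x ]        ≡⟨ []-* m x ⟨
    [ m ℕ.* x ]           ≡⟨ cong [_] (ℕ.*-comm m x) ⟩
    [ x ℕ.* m ]           ≡⟨ cong [_] 1+yv≡xm ⟨
    [ 1 ℕ.+ y ℕ.* v ]     ≡⟨ []-≡ ([m+kn]%n≡m%n 1 y v) ⟩
    1ᵥ                    ∎)
    where open ≡-Reasoning
  ... | Bézout.-+ x y 1+xm≡yv = -ᵥ [ x ] , (begin
    [ m ] *ᵥ -ᵥ [ x ]     ≡⟨ -‿distribʳ-* [ m ] [ x ] ⟨
    -ᵥ ([ m ] *ᵥ [ x ])   ≡⟨ +-inverseʳ-unique ([ m ] *ᵥ [ x ]) 1ᵥ mx+1≡0 ⟨
    1ᵥ                    ∎)
    where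
    open ≡-Reasoning
    mx+1≡0 : [ m ] *ᵥ [ x ] +ᵥ 1ᵥ ≡ 0ᵥ
    mx+1≡0 = begin
      [ m ] *ᵥ [ x ] +ᵥ 1ᵥ   ≡⟨ cong (_+ᵥ 1ᵥ) ([]-* m x) ⟨
      [ m ℕ.* x ] +ᵥ [ 1 ]   ≡⟨ []-+ (m ℕ.* x) 1 ⟨
      [ m ℕ.* x ℕ.+ 1 ]      ≡⟨ cong [_] (trans (ℕ.+-comm (m ℕ.* x) 1) (cong suc (ℕ.*-comm m x))) ⟩
      [ 1 ℕ.+ x ℕ.* m ]      ≡⟨ cong [_] 1+xm≡yv ⟩
      [ y ℕ.* v ]            ≡⟨ []-≡ (trans (m*n%n≡0 y v) (sym (m*n%n≡0 0 v))) ⟩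
      0ᵥ                     ∎

  coprime↔IsUnit : ∀ m → (gcd m v ≡ 1) ↔ IsUnit v [ m ]
  coprime↔IsUnit m = mk↔ₛ′ (coprime⇒IsUnit m) (IsUnit⇒coprime m)
    (λ u → IsUnit-irrelevant {[ m ]} _ u) (λ p → ℕ.≡-irrelevant _ p)

  [suc]≡1+ : ∀ i → [ suc (toℕ i) ] ≡ 1ᵥ +ᵥ i
  [suc]≡1+ i = trans ([]-+ 1 (toℕ i)) (cong (1ᵥ +ᵥ_) ([]-toℕ i))

  successor↔ : Fin v ↔ Fin v
  successor↔ = mk↔ₛ′ (λ i → [ suc (toℕ i) ]) (_-ᵥ 1ᵥ)
    (λ a → trans ([suc]≡1+ (a -ᵥ 1ᵥ)) (solve 1 (λ a → con (+ 1) :+ (a :- con (+ 1)) := a) refl a))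
    (λ i → trans (cong (_-ᵥ 1ᵥ) ([suc]≡1+ i)) (solve 1 (λ i → con (+ 1) :+ i :- con (+ 1) := i) refl i))

  Fin-φ↔ℤ* : Fin (φ v) ↔ ℤ*
  Fin-φ↔ℤ* = subst (λ xs → Fin (length (filter (λ m → gcd m v ℕ.≟ 1) xs)) ↔ ℤ*) (sym 1…v≡)
    (↔-trans (Fin-length-filter↔ (λ m → gcd m v ℕ.≟ 1) ℕ.≡-irrelevant (suc ∘ toℕ))
             (Σ-↔ successor↔ (λ {i} → coprime↔IsUnit (suc (toℕ i)))))
    where
    1…v≡ : map suc (upTo v) ≡ tabulate (suc ∘ toℕ)
    1…v≡ = trans (map-applyUpTo id suc v) (applyUpTo≡tabulate suc v)

  Fin-sumUnits↔ : (N : Fin v → ℕ) → Fin (sumUnits v N) ↔ Σ ℤ* (λ l → Fin (N (proj₁ l)))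
  Fin-sumUnits↔ N =
    ↔-trans (Fin-sum-filter↔ (isUnit? v) (λ {a} → IsUnit-irrelevant {a}) N id) (↔-sym Σ-assoc-alt)

  -- Counting orbits

  module OrbitCounting {k 𝒩 : ℕ} (orbits : IsOrbitCount v k 𝒩) (N : Fin v → ℕ)
    (counts : ∀ l → IsUnit v l → IsCount v (NSet v k l) (N l)) where

    R : Fin 𝒩 → Subset v
    R = proj₁ orbits

    R-Bcon : ∀ i → InBcon v k (R i)
    R-Bcon = proj₁ (proj₂ orbits)

    R-inequivalent : ∀ i j → AffEquiv v (R i) (R j) → i ≡ j
    R-inequivalent = proj₁ (proj₂ (proj₂ orbits))

    orbit : ∀ X → InBcon v k X → Fin 𝒩
    orbit X X∈Bcon = proj₁ (proj₂ (proj₂ (proj₂ orbits)) X X∈Bcon)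

    orbit-equiv : ∀ X (X∈Bcon : InBcon v k X) → AffEquiv v X (R (orbit X X∈Bcon))
    orbit-equiv X X∈Bcon = proj₂ (proj₂ (proj₂ (proj₂ orbits)) X X∈Bcon)

    enum : (l : ℤ*) → Fin (N (proj₁ l)) → Subset v
    enum (l , l-unit) = proj₁ (counts l l-unit)

    enum-injective : ∀ l {t t′} → enum l t ≡ enum l t′ → t ≡ t′
    enum-injective (l , l-unit) = proj₁ (proj₂ (counts l l-unit))

    enum-NSet : ∀ l t → NSet v k (proj₁ l) (enum l t)
    enum-NSet (l , l-unit) = proj₁ (proj₂ (proj₂ (counts l l-unit)))

    enum-surjective : ∀ l X → NSet v k (proj₁ l) X → ∃ λ t → enum l t ≡ X
    enum-surjective (l , l-unit) = proj₂ (proj₂ (proj₂ (counts l l-unit)))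

    Placement : Fin 𝒩 → Subset v → Set
    Placement i X = Σ ℤ* λ a → Σ (Elem (R i)) λ r → dilation (proj₁ a) (proj₁ r) (R i) ≡ X

    placement? : ∀ i X → Dec (Placement i X)
    placement? i X = map′ nest flatten
      (any? λ a → isUnit? v a ×-dec any? λ r → (r ∈? R i) ×-dec (≡-dec Bool._≟_ (dilation a r (R i)) X))
      where
      nest : (∃ λ a → IsUnit v a × ∃ λ r → r ∈ R i × dilation a r (R i) ≡ X) → Placement i X
      nest (a , a-unit , r , r∈ , eq) = (a , a-unit) , (r , r∈) , eq
      flatten : Placement i X → ∃ λ a → IsUnit v a × ∃ λ r → r ∈ R i × dilation a r (R i) ≡ X
      flatten ((a , a-unit) , (r , r∈) , eq) = a , a-unit , r , r∈ , eq

    -- The placement found by search depends on i and X only, not on the witness it is given.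
    opaque
      canonical : ∀ {i X} → Placement i X → Placement i X
      canonical {i} {X} = choose (placement? i X)

      canonical-cong : ∀ {i i′ X X′} → i ≡ i′ → X ≡ X′ → (p : Placement i X) (p′ : Placement i′ X′) →
        proj₁ (canonical p) ≡ proj₁ (canonical p′) ×
        proj₁ (proj₁ (proj₂ (canonical p))) ≡ proj₁ (proj₁ (proj₂ (canonical p′)))
      canonical-cong {i} {X = X} refl refl p p′ =
        cong proj₁ canonical-p≡p′ , cong (λ q → proj₁ (proj₁ (proj₂ q))) canonical-p≡p′
        where
        canonical-p≡p′ : canonical p ≡ canonical p′
        canonical-p≡p′ = choose-irrelevant (placement? i X) p p′

    opaque
      placement-of-equivalent : ∀ {i X} → AffEquiv v X (R i) → 0ᵥ ∈ X → Placement i X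
      placement-of-equivalent {i} {X} (α , α-unit , β , Ri≡αX+β) 0∈X =
        (α , α-unit) ⁻¹ , (β , β∈Ri) , trans (cong (dilation (proj₁ ((α , α-unit) ⁻¹)) β) Ri≡αX+β)
          (affImage-inverse α (proj₁ ((α , α-unit) ⁻¹)) β X (⁻¹-inverseˡ (α , α-unit)))
        where
        β∈Ri : β ∈ R i
        β∈Ri = subst (β ∈_) (sym Ri≡αX+β)
          (∈-affImage⁺ α β 0∈X (trans (cong (_+ᵥ β) (zeroʳ α)) (+ᵥ-identityˡ β)))

    Frames : Set
    Frames = Σ (Fin 𝒩) λ i → ℤ* × Elem (R i)

    NPairs : Set
    NPairs = Σ ℤ* λ l → Fin (N (proj₁ l))

    Frame-≡ : ∀ {i i′ a a′ r r′} → i ≡ i′ → a ≡ a′ → proj₁ r ≡ proj₁ r′ →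
      _≡_ {A = Frames} (i , a , r) (i′ , a′ , r′)
    Frame-≡ refl refl r≡r′ = cong (λ r → _ , _ , r) (Elem-≡ r≡r′)

    NPair-≡ : ∀ {l l′ t t′} → l ≡ l′ → enum l t ≡ enum l′ t′ → _≡_ {A = NPairs} (l , t) (l′ , t′)
    NPair-≡ {l} refl eq = cong (l ,_) (enum-injective l eq)

    -- (i , a , r) ↦ (l , X) with X = a (R i − r) and l = a a₀⁻¹ for the canonical placement (a₀ , r₀) of X.
    module Forward (i : Fin 𝒩) (a : ℤ*) (r : Elem (R i)) where

      X : Subset v
      X = dilation (proj₁ a) (proj₁ r) (R i)

      base : Placement i X
      base = canonical (a , r , refl)

      a₀ : ℤ*
      a₀ = proj₁ base

      r₀ : Elem (R i)
      r₀ = proj₁ (proj₂ base)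

      l : ℤ*
      l = a · a₀ ⁻¹

      x : Fin v
      x = proj₁ a *ᵥ (proj₁ r₀ -ᵥ proj₁ r)

      lX≡X-x : scale (proj₁ l) X ≡ translate (-ᵥ x) X
      lX≡X-x = begin
        scale (proj₁ l) X
          ≡⟨ cong (scale (proj₁ l)) (proj₂ (proj₂ base)) ⟨
        scale (proj₁ l) (dilation (proj₁ a₀) (proj₁ r₀) (R i))
          ≡⟨ scale-dilation (proj₁ l) (proj₁ a₀) (proj₁ r₀) (R i) ⟩
        dilation (proj₁ l *ᵥ proj₁ a₀) (proj₁ r₀) (R i)
          ≡⟨ cong (λ c → dilation c (proj₁ r₀) (R i)) la₀≡a ⟩
        dilation (proj₁ a) (proj₁ r₀) (R i)
          ≡⟨ translate-dilation (proj₁ a) (proj₁ r) (proj₁ r₀) (R i) ⟨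
        translate (-ᵥ x) X
          ∎
        where
        open ≡-Reasoning
        la₀≡a : proj₁ l *ᵥ proj₁ a₀ ≡ proj₁ a
        la₀≡a = trans (sym (proj₁-· l a₀)) (cong proj₁ (x·y⁻¹·y≡x a a₀))

      X∈NSet : NSet v k (proj₁ l) X
      X∈NSet = InBcon-affImage (proj₁ a) _ (proj₂ a) (R-Bcon i) , 0∈dilation⁺ (proj₁ a) (proj₂ r) ,
               x , ∈-dilation (proj₁ a) (proj₁ r) (proj₂ r₀) , lX≡X-x

      opaque
        t : Fin (N (proj₁ l))
        t = proj₁ (enum-surjective l X X∈NSet)

        enum-t : enum l t ≡ X
        enum-t = proj₂ (enum-surjective l X X∈NSet)

    -- (l , X) ↦ (i , a , r) with a = l a₀ and r = r₀ − a⁻¹ x, where l X = X − x and (a₀ , r₀) places X in R i.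
    module Backward (l : ℤ*) (t : Fin (N (proj₁ l))) where

      X : Subset v
      X = enum l t

      X∈Bcon : InBcon v k X
      X∈Bcon = proj₁ (enum-NSet l t)

      0∈X : 0ᵥ ∈ X
      0∈X = proj₁ (proj₂ (enum-NSet l t))

      x : Fin v
      x = proj₁ (proj₂ (proj₂ (enum-NSet l t)))

      lX≡X-x : scale (proj₁ l) X ≡ translate (-ᵥ x) X
      lX≡X-x = proj₂ (proj₂ (proj₂ (proj₂ (enum-NSet l t))))

      i : Fin 𝒩
      i = orbit X X∈Bcon

      base : Placement i X
      base = canonical (placement-of-equivalent (orbit-equiv X X∈Bcon) 0∈X)

      a₀ : ℤ*
      a₀ = proj₁ base

      r₀ : Fin v
      r₀ = proj₁ (proj₁ (proj₂ base))

      a : ℤ*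
      a = l · a₀

      r′ : Fin v
      r′ = r₀ -ᵥ proj₁ (a ⁻¹) *ᵥ x

      aR-r′≡X : dilation (proj₁ a) r′ (R i) ≡ X
      aR-r′≡X = translate-injective (-ᵥ x) (begin
        translate (-ᵥ x) (dilation (proj₁ a) r′ (R i))
          ≡⟨ cong (λ y → translate (-ᵥ y) (dilation (proj₁ a) r′ (R i)))
                  (a[r₀-[r₀-mx]]≡x (proj₁ a) (proj₁ (a ⁻¹)) r₀ x (⁻¹-inverseʳ a)) ⟨
        translate (-ᵥ (proj₁ a *ᵥ (r₀ -ᵥ r′))) (dilation (proj₁ a) r′ (R i))
          ≡⟨ translate-dilation (proj₁ a) r′ r₀ (R i) ⟩
        dilation (proj₁ (l · a₀)) r₀ (R i)           ≡⟨ cong (λ c → dilation c r₀ (R i)) (proj₁-· l a₀) ⟩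
        dilation (proj₁ l *ᵥ proj₁ a₀) r₀ (R i)      ≡⟨ scale-dilation (proj₁ l) (proj₁ a₀) r₀ (R i) ⟨
        scale (proj₁ l) (dilation (proj₁ a₀) r₀ (R i)) ≡⟨ cong (scale (proj₁ l)) (proj₂ (proj₂ base)) ⟩
        scale (proj₁ l) X                            ≡⟨ lX≡X-x ⟩
        translate (-ᵥ x) X                           ∎)
        where open ≡-Reasoning

      opaque
        r′∈Ri : r′ ∈ R i
        r′∈Ri = 0∈dilation⁻ (proj₁ a) r′ (R i) (proj₂ a) (subst (0ᵥ ∈_) (sym aR-r′≡X) 0∈X)

      r : Elem (R i)
      r = r′ , r′∈Ri

    to-npair : Frames → NPairs
    to-npair (i , a , r) = Forward.l i a r , Forward.t i a r

    to-frame : NPairs → Frames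
    to-frame (l , t) = Backward.i l t , Backward.a l t , Backward.r l t

    to-npair∘to-frame : ∀ p → to-npair (to-frame p) ≡ p
    to-npair∘to-frame (l , t) = NPair-≡ {F.l} {l} {F.t} {t} l′≡l (trans F.enum-t B.aR-r′≡X)
      where
      module B = Backward l t
      module F = Forward B.i B.a B.r
      B-placement : Placement B.i B.X
      B-placement = placement-of-equivalent {B.i} {B.X} (orbit-equiv B.X B.X∈Bcon) B.0∈X
      F-placement : Placement B.i F.X
      F-placement = B.a , B.r , refl
      a₀′≡a₀ : F.a₀ ≡ B.a₀
      a₀′≡a₀ = proj₁ (canonical-cong {B.i} {B.i} {F.X} {B.X} refl B.aR-r′≡X F-placement B-placement)
      l′≡l : F.l ≡ l
      l′≡l = trans (cong (λ c → B.a · c ⁻¹) a₀′≡a₀) (x·y·y⁻¹≡x l B.a₀)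

    to-frame∘to-npair : ∀ f → to-frame (to-npair f) ≡ f
    to-frame∘to-npair (i , a , r) = Frame-≡ {B.i} {i} {B.a} {a} {B.r} {r} (sym i≡i′) a′≡a r′≡r
      where
      module F = Forward i a r
      module B = Backward F.l F.t
      X′≡X : B.X ≡ F.X
      X′≡X = F.enum-t
      i≡i′ : i ≡ B.i
      i≡i′ = R-inequivalent i B.i (AffEquiv-trans {R i} {F.X} {R B.i} (proj₁ a , proj₂ a , -ᵥ (proj₁ a *ᵥ proj₁ r) , refl)
        (subst (λ Y → AffEquiv v Y (R B.i)) X′≡X (orbit-equiv B.X B.X∈Bcon)))
      B-placement : Placement B.i B.X
      B-placement = placement-of-equivalent {B.i} {B.X} (orbit-equiv B.X B.X∈Bcon) B.0∈X
      F-placement : Placement i F.X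
      F-placement = a , r , refl
      base′≡base : B.a₀ ≡ F.a₀ × B.r₀ ≡ proj₁ F.r₀
      base′≡base = canonical-cong {B.i} {i} {B.X} {F.X} (sym i≡i′) X′≡X B-placement F-placement
      a₀′≡a₀ : B.a₀ ≡ F.a₀
      a₀′≡a₀ = proj₁ base′≡base
      r₀′≡r₀ : B.r₀ ≡ proj₁ F.r₀
      r₀′≡r₀ = proj₂ base′≡base
      a′≡a : B.a ≡ a
      a′≡a = trans (cong (F.l ·_) a₀′≡a₀) (x·y⁻¹·y≡x a F.a₀)
      x′≡x : B.x ≡ F.x
      x′≡x = shift-unique {X = B.X} {l = proj₁ F.l} (proj₁ B.X∈Bcon) B.0∈X B.lX≡X-x
        (subst (λ Y → scale (proj₁ F.l) Y ≡ translate (-ᵥ F.x) Y) (sym X′≡X) F.lX≡X-x)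
      r′≡r : B.r′ ≡ proj₁ r
      r′≡r = begin
        B.r₀ -ᵥ proj₁ (B.a ⁻¹) *ᵥ B.x
          ≡⟨ cong₂ (λ r₀ c → r₀ -ᵥ proj₁ (c ⁻¹) *ᵥ B.x) {B.r₀} {proj₁ F.r₀} {B.a} {a} r₀′≡r₀ a′≡a ⟩
        proj₁ F.r₀ -ᵥ proj₁ (a ⁻¹) *ᵥ B.x
          ≡⟨ cong (λ y → proj₁ F.r₀ -ᵥ proj₁ (a ⁻¹) *ᵥ y) {B.x} {F.x} x′≡x ⟩
        proj₁ F.r₀ -ᵥ proj₁ (a ⁻¹) *ᵥ F.x
          ≡⟨ r₀-m[a[r₀-r]]≡r (proj₁ a) (proj₁ (a ⁻¹)) (proj₁ F.r₀) (proj₁ r) (⁻¹-inverseˡ a) ⟩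
        proj₁ r ∎
        where open ≡-Reasoning

    Frames↔NPairs : Frames ↔ NPairs
    Frames↔NPairs = mk↔ₛ′ to-npair to-frame to-npair∘to-frame to-frame∘to-npair

    Fin↔Frames : Fin (𝒩 ℕ.* (φ v ℕ.* k)) ↔ Frames
    Fin↔Frames =
      ↔-trans *↔× (↔-trans (↔-refl ×-↔ *↔×) (Σ-↔ ↔-refl (λ {i} → Fin-φ↔ℤ* ×-↔ Fin-k↔Elem i)))
      where
      Fin-k↔Elem : ∀ i → Fin k ↔ Elem (R i)
      Fin-k↔Elem i = subst (λ n → Fin n ↔ Elem (R i)) (proj₁ (proj₁ (R-Bcon i))) (Fin∣∣↔Elem (R i))

    orbit-count : 𝒩 ℕ.* (φ v ℕ.* k) ≡ sumUnits v N
    orbit-count = ↔⇒≡ (↔-trans Fin↔Frames (↔-trans Frames↔NPairs (↔-sym (Fin-sumUnits↔ N))))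

lemma15 : (v k : ℕ) .{{_ : NonZero v}} → 3 ≤ k → k * k ∸ k + 1 ≤ v →
    (𝒩 : ℕ) → IsOrbitCount v k 𝒩 →
    (N : Fin v → ℕ) → (∀ l → IsUnit v l → IsCount v (NSet v k l) (N l)) →
    k * φ v * 𝒩 ≡ sumUnits v N
lemma15 v k _ _ 𝒩 orbits N counts = begin
  k * φ v * 𝒩     ≡⟨ ℕ.*-comm (k * φ v) 𝒩 ⟩
  𝒩 * (k * φ v)   ≡⟨ cong (𝒩 *_) (ℕ.*-comm k (φ v)) ⟩
  𝒩 * (φ v * k)   ≡⟨ Mod.OrbitCounting.orbit-count v orbits N counts ⟩
  sumUnits v N    ∎
  where open ≡-Reasoning
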